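{- Let $K$ be a field, let $X\in K[[z]]$ and let $A(t)=\sum_{j\le m}A_j t^j\in K[[z]][t]$. Then for every integer $n\ge 0$ and every integer $\lambda$ with $0\le\lambda< n/2$, \[ (A(X))_n = \sum_{\ell<\lambda} (A'(X))_\ell\, X_{n-\ell} + \gamma_{n,\lambda}(A,X) + \delta_n(A,X) + \epsilon_n(A,X), \] where \[ \gamma_{n,\lambda}(A,X) = \sum_{\lambda\le \ell< n/2} (A'(X))_\ell\, X_{n-\ell},\qquad \delta_n(A,X) = \Big(\sum_{j\le m} A_j X^{[j]}\Big)_n, \] \[ \epsilon_n(A,X) = \sum_{j\le m}\ \sum_{\substack{k+p+q=n\\ q<p\le n/2}} j\,(A_j)_k\,(X^{j-1})_q\, X_p . \]
   Context: For $C\in K[[z]]$, $C_n$ denotes the coefficient of $z^n$ (indices nonnegative; all summation indices $k,p,q,\ell$ are nonnegative integers). $A'(t)=\sum_{j\le m} jA_jt^{j-1}$ is the formal derivative (the $j=0$ term being $0$), and $A(X), A'(X)$ denote evaluation at $X$. For an integer $j\ge0$, $X^{[j]}\in K[[z]]$ is the power series with coefficients \[ (X^{[j]})_n = \sum_{\substack{k_1+\dots+k_j=n\\ k_1,\dots,k_j\le n/2}} X_{k_1}\cdots X_{k_j} \] (the sum over $j$-tuples of nonnegative integers; for $j=0$ this gives $X^{[0]}=1$). In $\epsilon_n$, the $j=0$ terms are $0$. -}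

module Defs where

open import Level using (Level; _⊔_)
open import Algebra.Bundles using (CommutativeRing)
open import Data.Nat as ℕ using (ℕ; zero; suc; _∸_)
import Data.Nat.Properties as ℕP
open import Data.Bool using (if_then_else_)
open import Data.Product using (Σ; _×_)
open import Relation.Nullary using (¬_; Dec)
open import Relation.Nullary.Decidable using (⌊_⌋; _×-dec_)
open import Relation.Binary.PropositionalEquality using (_≡_)

record IsField {c ℓ : Level} (R : CommutativeRing c ℓ) : Set (c ⊔ ℓ) where
  open CommutativeRing R public
  field
    0≉1     : ¬ (0# ≈ 1#)
    inverse : ∀ x → ¬ (x ≈ 0#) → Σ Carrier (λ y → x * y ≈ 1#)

module PS {c ℓ : Level} (R : CommutativeRing c ℓ) where
  open CommutativeRing R public

  Series : Set c
  Series = ℕ → Carrier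

  Σ< : ℕ → (ℕ → Carrier) → Carrier
  Σ< zero    f = 0#
  Σ< (suc N) f = Σ< N f + f N

  Σ≤ : ℕ → (ℕ → Carrier) → Carrier
  Σ≤ n f = Σ< (suc n) f

  when : {p : Level} {P : Set p} → Dec P → Carrier → Carrier
  when d x = if ⌊ d ⌋ then x else 0#

  _·_ : ℕ → Carrier → Carrier
  zero  · x = 0#
  suc j · x = x + j · x

  one : Series
  one zero    = 1#
  one (suc n) = 0#

  _⊛_ : Series → Series → Series
  (f ⊛ g) n = Σ≤ n (λ k → f k * g (n ∸ k))

  pow : Series → ℕ → Series
  pow X zero    = one
  pow X (suc j) = X ⊛ pow X j

  -- A polynomial A(t) = Σ_{j ≤ m} A_j t^j with coefficients A_j ∈ K[[z]]
  -- is given by its degree bound m and its coefficient family A : ℕ → Series.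
  -- (A(X))_n
  evalP : ℕ → (ℕ → Series) → Series → Series
  evalP m A X n = Σ≤ m (λ j → (A j ⊛ pow X j) n)

  -- (A'(X))_n, with A'(t) = Σ_{j ≤ m} j A_j t^{j-1} (j = 0 term is 0)
  evalD : ℕ → (ℕ → Series) → Series → Series
  evalD m A X n = Σ≤ m (λ j → j · (A j ⊛ pow X (j ∸ 1)) n)

  -- restricted power: sum over j-tuples (k_1,…,k_j) summing to n with 2 k_i ≤ b
  rpow : Series → ℕ → ℕ → Series
  rpow X b zero    zero    = 1#
  rpow X b zero    (suc n) = 0#
  rpow X b (suc j) n = Σ≤ n (λ k → when (2 ℕ.* k ℕP.≤? b) (X k * rpow X b j (n ∸ k)))

  -- X^[j] : (X^[j])_n = Σ_{k_1+…+k_j = n, k_i ≤ n/2} X_{k_1}⋯X_{k_j}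
  brk : Series → ℕ → Series
  brk X j n = rpow X n j n

  headSum : ℕ → (ℕ → Series) → Series → ℕ → ℕ → Carrier
  headSum m A X n lam = Σ< lam (λ l → evalD m A X l * X (n ∸ l))

  γ : ℕ → (ℕ → Series) → Series → ℕ → ℕ → Carrier
  γ m A X n lam =
    Σ< n (λ l → when ((lam ℕP.≤? l) ×-dec (2 ℕ.* l ℕP.<? n)) (evalD m A X l * X (n ∸ l)))

  δ : ℕ → (ℕ → Series) → Series → ℕ → Carrier
  δ m A X n = Σ≤ m (λ j → (A j ⊛ brk X j) n)

  ε : ℕ → (ℕ → Series) → Series → ℕ → Carrier
  ε m A X n =
    Σ≤ m (λ j → Σ≤ n (λ k → Σ≤ n (λ p → Σ≤ n (λ q →
      when ((k ℕ.+ p ℕ.+ q ℕ.≟ n) ×-dec ((q ℕP.<? p) ×-dec (2 ℕ.* p ℕP.≤? n)))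
           (j · (A j k * pow X (j ∸ 1) q * X p))))))

-- For N ≤ b, a tuple of indices with sum N has at most one entry k with 2k > b.  Taking
-- b = N this gives (X^j)_N = (X^[j])_N + j Σ_{2p>N} X_p (X^{j-1})_{N-p}, so (A_j X^j)_n is
-- the j-th summand of δ plus j Σ (A_j)_k (X^{j-1})_q X_p over k + p + q = n with q < p.
-- The terms with 2p ≤ n make up ε; those with 2p > n regroup, with ℓ = n - p, into
-- Σ_{2ℓ<n} (A'(X))_ℓ X_{n-ℓ}, which splits at λ into the head sum and γ.
module Submission where

open import Defs
open import Level using (Level)
open import Algebra.Bundles using (CommutativeRing)
open import Data.Nat using (ℕ; zero; suc; _∸_; _≤_; _<_; s≤s)
import Data.Nat as ℕ
import Data.Nat.Properties as ℕP
open ℕP using (_≟_; _≤?_; _<?_)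
open import Data.Product using (_,_; proj₁; proj₂)
open import Data.Sum using (_⊎_; inj₁; inj₂; [_,_]; map₂)
open import Data.Empty using (⊥-elim)
open import Data.Unit using (tt)
open import Relation.Nullary using (Dec; yes; no; ¬_)
open import Relation.Nullary.Decidable using (_×-dec_)
open import Relation.Binary.PropositionalEquality as ≡ using (_≡_; _≢_)

module Arithmetic where
  open Data.Nat using (_+_; _*_)
  open ℕP

  2*≡+ : ∀ x → 2 * x ≡ x + x
  2*≡+ x = ≡.cong (x +_) (+-identityʳ x)

  m≤o∸n⇒n≤o∸m : ∀ {m n o} → n ≤ o → m ≤ o ∸ n → n ≤ o ∸ m
  m≤o∸n⇒n≤o∸m {m} {n} {o} n≤o m≤o∸n =
    m+n≤o⇒m≤o∸n n (≡.subst (_≤ o) (+-comm m n) (m≤o∸n⇒m+n≤o m n≤o m≤o∸n))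

  m+n≤o⇒n≤o∸m : ∀ {m n o} → m + n ≤ o → n ≤ o ∸ m
  m+n≤o⇒n≤o∸m {m} {n} {o} le = m+n≤o⇒m≤o∸n n (≡.subst (_≤ o) (+-comm m n) le)

  m≤o⇒n≤o∸m⇒m+n≤o : ∀ {m n o} → m ≤ o → n ≤ o ∸ m → m + n ≤ o
  m≤o⇒n≤o∸m⇒m+n≤o {m} {n} {o} m≤o n≤o∸m =
    ≡.subst (_≤ o) (+-comm n m) (m≤o∸n⇒m+n≤o n m≤o n≤o∸m)

  ∸<⇒<2* : ∀ {m n} → n ≤ m → m ∸ n < n → m < 2 * n
  ∸<⇒<2* {m} {n} n≤m lt =
    ≡.subst₂ _<_ (m∸n+n≡m n≤m) (≡.sym (2*≡+ n)) (+-monoˡ-< n lt)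

  <2*⇒∸< : ∀ {m n} → n ≤ m → m < 2 * n → m ∸ n < n
  <2*⇒∸< {m} {n} n≤m lt =
    +-cancelʳ-< n (m ∸ n) n (≡.subst₂ _<_ (≡.sym (m∸n+n≡m n≤m)) (2*≡+ n) lt)

  2*[m∸n]<m⇒m<2*n : ∀ {m n} → n ≤ m → 2 * (m ∸ n) < m → m < 2 * n
  2*[m∸n]<m⇒m<2*n {m} {n} n≤m lt = ∸<⇒<2* n≤m (+-cancelˡ-< (m ∸ n) (m ∸ n) n
    (≡.subst₂ _<_ (2*≡+ (m ∸ n)) (≡.sym (m∸n+n≡m n≤m)) lt))

  m<2*n⇒2*[m∸n]<m : ∀ {m n} → n ≤ m → m < 2 * n → 2 * (m ∸ n) < m
  m<2*n⇒2*[m∸n]<m {m} {n} n≤m lt =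
    ≡.subst₂ _<_ (≡.sym (2*≡+ (m ∸ n))) (m∸n+n≡m n≤m)
      (+-monoʳ-< (m ∸ n) (<2*⇒∸< n≤m lt))

  +≤⇒<2*⇒2*≤ : ∀ {m n b} → m + n ≤ b → b < 2 * n → 2 * m ≤ b
  +≤⇒<2*⇒2*≤ {m} {n} {b} m+n≤b b<2n = ≤-trans (≡.subst (_≤ m + n) (≡.sym (2*≡+ m))
    (+-monoʳ-≤ m (<⇒≤ m<n))) m+n≤b
    where
    m<n : m < n
    m<n = +-cancelʳ-< n m n (≡.subst (m + n <_) (2*≡+ n) (≤-trans (s≤s m+n≤b) b<2n))

  ∸-∸-comm : ∀ m n o → m ∸ n ∸ o ≡ m ∸ o ∸ n
  ∸-∸-comm m n o =
    ≡.trans (∸-+-assoc m n o) (≡.trans (≡.cong (m ∸_) (+-comm n o)) (≡.sym (∸-+-assoc m o n)))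

open Arithmetic

module Expansion {c ℓ : Level} (K : CommutativeRing c ℓ) where
  open PS K hiding (zero)
  open import Relation.Binary.Reasoning.Setoid setoid
  open import Algebra.Properties.CommutativeSemigroup +-commutativeSemigroup using (interchange)
  open import Algebra.Properties.CommutativeSemigroup *-commutativeSemigroup
    using (x∙yz≈y∙xz; x∙yz≈xz∙y)

  ·-congʳ : ∀ j {x y} → x ≈ y → j · x ≈ j · y
  ·-congʳ zero    x≈y = refl
  ·-congʳ (suc j) x≈y = +-cong x≈y (·-congʳ j x≈y)

  ·-zeroʳ : ∀ j → j · 0# ≈ 0#
  ·-zeroʳ zero    = refl
  ·-zeroʳ (suc j) = trans (+-identityˡ _) (·-zeroʳ j)

  ·-distrib-+ : ∀ j x y → j · (x + y) ≈ j · x + j · y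
  ·-distrib-+ zero    x y = sym (+-identityˡ 0#)
  ·-distrib-+ (suc j) x y = trans (+-congˡ (·-distrib-+ j x y)) (interchange x y (j · x) (j · y))

  ·-comm-* : ∀ j x y → x * (j · y) ≈ j · (x * y)
  ·-comm-* zero    x y = zeroʳ x
  ·-comm-* (suc j) x y = trans (distribˡ x y (j · y)) (+-congˡ (·-comm-* j x y))

  ·-assoc-* : ∀ j x y → (j · x) * y ≈ j · (x * y)
  ·-assoc-* zero    x y = zeroˡ y
  ·-assoc-* (suc j) x y = trans (distribʳ y x (j · x)) (+-congˡ (·-assoc-* j x y))

  module _ {p} {P : Set p} where

    when-true : (d : Dec P) {x : Carrier} → P → when d x ≈ x
    when-true (yes _) _ = refl
    when-true (no ¬P) P = ⊥-elim (¬P P)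

    when-false : (d : Dec P) {x : Carrier} → ¬ P → when d x ≈ 0#
    when-false (yes P) ¬P = ⊥-elim (¬P P)
    when-false (no _)  _  = refl

    when-zero : (d : Dec P) {x : Carrier} → (P → x ≈ 0#) → when d x ≈ 0#
    when-zero (yes P) x≈0 = x≈0 P
    when-zero (no _)  _   = refl

    when-congʳ : (d : Dec P) {x y : Carrier} → x ≈ y → when d x ≈ when d y
    when-congʳ (yes _) x≈y = x≈y
    when-congʳ (no _)  _   = refl

    when-distrib-+ : (d : Dec P) (x y : Carrier) → when d (x + y) ≈ when d x + when d y
    when-distrib-+ (yes _) x y = refl
    when-distrib-+ (no _)  x y = sym (+-identityˡ 0#)

    *-when : (d : Dec P) (x y : Carrier) → x * when d y ≈ when d (x * y)
    *-when (yes _) x y = refl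
    *-when (no _)  x y = zeroʳ x

    ·-when : (d : Dec P) (j : ℕ) (x : Carrier) → j · when d x ≈ when d (j · x)
    ·-when (yes _) j x = refl
    ·-when (no _)  j x = ·-zeroʳ j

  module _ {p q} {P : Set p} {Q : Set q} where

    when-×-dec : (d : Dec P) (e : Dec Q) {x : Carrier} → when (d ×-dec e) x ≈ when d (when e x)
    when-×-dec (yes _) (yes _) = refl
    when-×-dec (yes _) (no _)  = refl
    when-×-dec (no _)  _       = refl

    when-⇔ : (d : Dec P) (e : Dec Q) {x : Carrier} → (P → Q) → (Q → P) → when d x ≈ when e x
    when-⇔ d (yes Q) P→Q Q→P = when-true d (Q→P Q)
    when-⇔ d (no ¬Q) P→Q Q→P = when-false d (λ P → ¬Q (P→Q P))

  when-partition : ∀ {p q r} {P : Set p} {Q : Set q} {R : Set r}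
    (d : Dec P) (e : Dec Q) (f : Dec R) {x : Carrier} →
    (P → ¬ Q) → (P → R) → (Q → R) → (R → P ⊎ Q) → when d x + when e x ≈ when f x
  when-partition (yes P) (yes Q) f P⊥Q _ _ _ = ⊥-elim (P⊥Q P Q)
  when-partition (yes P) (no _)  f _ P→R _ _ = trans (+-identityʳ _) (sym (when-true f (P→R P)))
  when-partition (no _)  (yes Q) f _ _ Q→R _ = trans (+-identityˡ _) (sym (when-true f (Q→R Q)))
  when-partition (no ¬P) (no ¬Q) f _ _ _ R→P⊎Q =
    trans (+-identityˡ 0#) (sym (when-false f (λ R → [ ¬P , ¬Q ] (R→P⊎Q R))))

  when-complement : ∀ {p q} {P : Set p} {Q : Set q} (d : Dec P) (e : Dec Q) {x : Carrier} →
    (P → ¬ Q) → P ⊎ Q → x ≈ when d x + when e x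
  when-complement d e P⊥Q P⊎Q =
    sym (when-partition d e (yes tt) P⊥Q (λ _ → tt) (λ _ → tt) (λ _ → P⊎Q))

  when-⇒ : ∀ {p q} {P : Set p} {Q : Set q} (d : Dec P) (e : Dec Q) {x : Carrier} →
    (Q → P) → when d (when e x) ≈ when e x
  when-⇒ d (yes Q) Q→P = when-true d (Q→P Q)
  when-⇒ d (no _)  _   = when-zero d (λ _ → refl)

  Σ-cong : ∀ N {f g} → (∀ i → i < N → f i ≈ g i) → Σ< N f ≈ Σ< N g
  Σ-cong zero    f≈g = refl
  Σ-cong (suc N) f≈g = +-cong (Σ-cong N (λ i i<N → f≈g i (ℕP.m<n⇒m<1+n i<N))) (f≈g N ℕP.≤-refl)

  Σ-zero : ∀ N {f} → (∀ i → i < N → f i ≈ 0#) → Σ< N f ≈ 0#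
  Σ-zero N f≈0 = trans (Σ-cong N f≈0) (Σ-const0 N)
    where
    Σ-const0 : ∀ N → Σ< N (λ _ → 0#) ≈ 0#
    Σ-const0 zero    = refl
    Σ-const0 (suc N) = trans (+-identityʳ _) (Σ-const0 N)

  Σ-distrib-+ : ∀ N f g → Σ< N (λ i → f i + g i) ≈ Σ< N f + Σ< N g
  Σ-distrib-+ zero    f g = sym (+-identityˡ 0#)
  Σ-distrib-+ (suc N) f g = trans (+-congʳ (Σ-distrib-+ N f g)) (interchange _ _ _ _)

  *-distribˡ-Σ : ∀ N x f → x * Σ< N f ≈ Σ< N (λ i → x * f i)
  *-distribˡ-Σ zero    x f = zeroʳ x
  *-distribˡ-Σ (suc N) x f = trans (distribˡ x _ _) (+-congʳ (*-distribˡ-Σ N x f))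

  *-distribʳ-Σ : ∀ N x f → Σ< N f * x ≈ Σ< N (λ i → f i * x)
  *-distribʳ-Σ zero    x f = zeroˡ x
  *-distribʳ-Σ (suc N) x f = trans (distribʳ x _ _) (+-congʳ (*-distribʳ-Σ N x f))

  ·-distrib-Σ : ∀ N j f → j · Σ< N f ≈ Σ< N (λ i → j · f i)
  ·-distrib-Σ zero    j f = ·-zeroʳ j
  ·-distrib-Σ (suc N) j f = trans (·-distrib-+ j _ _) (+-congʳ (·-distrib-Σ N j f))

  when-Σ : ∀ {p} {P : Set p} (d : Dec P) N f → when d (Σ< N f) ≈ Σ< N (λ i → when d (f i))
  when-Σ (yes _) N f = refl
  when-Σ (no _)  N f = sym (Σ-zero N (λ _ _ → refl))

  Σ-swap : ∀ M N (f : ℕ → ℕ → Carrier) →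
    Σ< M (λ i → Σ< N (f i)) ≈ Σ< N (λ j → Σ< M (λ i → f i j))
  Σ-swap zero    N f = sym (Σ-zero N (λ _ _ → refl))
  Σ-swap (suc M) N f = trans (+-congʳ (Σ-swap M N f)) (sym (Σ-distrib-+ N _ _))

  Σ-reverse : ∀ n f → Σ≤ n f ≈ Σ≤ n (λ i → f (n ∸ i))
  Σ-reverse zero    f = refl
  Σ-reverse (suc n) f = begin
    Σ≤ n f + f (suc n)                              ≈⟨ +-congʳ (Σ-reverse n f) ⟩
    Σ≤ n (λ i → f (n ∸ i)) + f (suc n)              ≈⟨ +-comm _ _ ⟩
    f (suc n) + Σ≤ n (λ i → f (n ∸ i))              ≈⟨ sym (Σ-peel-first (suc n) _) ⟩
    Σ≤ (suc n) (λ i → f (suc n ∸ i))                ∎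
    where
    Σ-peel-first : ∀ N g → Σ< (suc N) g ≈ g 0 + Σ< N (λ i → g (suc i))
    Σ-peel-first zero    g = +-comm 0# (g 0)
    Σ-peel-first (suc N) g = trans (+-congʳ (Σ-peel-first N g)) (+-assoc _ _ _)

  Σ-single : ∀ N c {f} → c < N → (∀ i → i < N → i ≢ c → f i ≈ 0#) → Σ< N f ≈ f c
  Σ-single zero    c () _
  Σ-single (suc N) c {f} c<1+N f≈0 with c ≟ N
  ... | yes ≡.refl = trans (+-congʳ (Σ-zero N (λ i i<N → f≈0 i (ℕP.m<n⇒m<1+n i<N)
                             (λ { ≡.refl → ℕP.<-irrefl ≡.refl i<N })))) (+-identityˡ _)
  ... | no c≢N = trans (+-cong (Σ-single N c (ℕP.≤∧≢⇒< (ℕP.≤-pred c<1+N) c≢N)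
                                  (λ i i<N → f≈0 i (ℕP.m<n⇒m<1+n i<N)))
                               (f≈0 N ℕP.≤-refl (λ N≡c → c≢N (≡.sym N≡c))))
                       (+-identityʳ _)

  Σ-truncate : ∀ N M {f} → M ≤ N → (∀ i → M ≤ i → i < N → f i ≈ 0#) → Σ< N f ≈ Σ< M f
  Σ-truncate N M M≤N f≈0 with ℕP.m≤n⇒m<n∨m≡n M≤N
  ... | inj₂ ≡.refl = refl
  Σ-truncate (suc N) M {f} _ f≈0 | inj₁ M<1+N =
    trans (+-cong (Σ-truncate N M (ℕP.≤-pred M<1+N) (λ i M≤i i<N → f≈0 i M≤i (ℕP.m<n⇒m<1+n i<N)))
                  (f≈0 N (ℕP.≤-pred M<1+N) ℕP.≤-refl))
          (+-identityʳ _)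

  Σ-restrict : ∀ {p} {P : ℕ → Set p} (P? : ∀ i → Dec (P i)) M N g → M ≤ N →
    (∀ i → i < M → P i) → (∀ i → M ≤ i → ¬ P i) →
    Σ< M g ≈ Σ< N (λ i → when (P? i) (g i))
  Σ-restrict P? M N g M≤N inside outside = begin
    Σ< M g
      ≈⟨ Σ-cong M (λ i i<M → sym (when-true (P? i) (inside i i<M))) ⟩
    Σ< M (λ i → when (P? i) (g i))
      ≈⟨ sym (Σ-truncate N M M≤N (λ i M≤i _ → when-false (P? i) (outside i M≤i))) ⟩
    Σ< N (λ i → when (P? i) (g i)) ∎

  Σ≤-restrict : ∀ M N g → M ≤ N → Σ≤ M g ≈ Σ≤ N (λ i → when (i ≤? M) (g i))
  Σ≤-restrict M N g M≤N =
    Σ-restrict (_≤? M) (suc M) (suc N) g (s≤s M≤N) (λ _ → ℕP.≤-pred) (λ _ → ℕP.<⇒≱)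

  Σ-triangle : ∀ N (f : ℕ → ℕ → Carrier) →
    Σ≤ N (λ k → Σ≤ (N ∸ k) (f k)) ≈ Σ≤ N (λ p → Σ≤ (N ∸ p) (λ k → f k p))
  Σ-triangle N f = begin
    Σ≤ N (λ k → Σ≤ (N ∸ k) (f k))
      ≈⟨ Σ-cong (suc N) (λ k _ → Σ≤-restrict (N ∸ k) N (f k) (ℕP.m∸n≤m N k)) ⟩
    Σ≤ N (λ k → Σ≤ N (λ p → when (p ≤? N ∸ k) (f k p)))
      ≈⟨ Σ-swap (suc N) (suc N) _ ⟩
    Σ≤ N (λ p → Σ≤ N (λ k → when (p ≤? N ∸ k) (f k p)))
      ≈⟨ Σ-cong (suc N) (λ p p≤N → Σ-cong (suc N) (λ k k≤N →
           when-⇔ (p ≤? N ∸ k) (k ≤? N ∸ p)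
             (m≤o∸n⇒n≤o∸m (ℕP.≤-pred k≤N)) (m≤o∸n⇒n≤o∸m (ℕP.≤-pred p≤N)))) ⟩
    Σ≤ N (λ p → Σ≤ N (λ k → when (k ≤? N ∸ p) (f k p)))
      ≈⟨ Σ-cong (suc N) (λ p _ → sym (Σ≤-restrict (N ∸ p) N (λ k → f k p) (ℕP.m∸n≤m N p))) ⟩
    Σ≤ N (λ p → Σ≤ (N ∸ p) (λ k → f k p)) ∎

  Σ-antidiagonal : ∀ n s (g : ℕ → Carrier) →
    Σ≤ n (λ q → when (s ℕ.+ q ≟ n) (g q)) ≈ when (s ≤? n) (g (n ∸ s))
  Σ-antidiagonal n s g with s ≤? n
  ... | yes s≤n = trans
    (Σ-single (suc n) (n ∸ s) {λ q → when (s ℕ.+ q ≟ n) (g q)} (s≤s (ℕP.m∸n≤m n s)) off-diagonal)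
    (when-true (s ℕ.+ (n ∸ s) ≟ n) (ℕP.m+[n∸m]≡n s≤n))
    where
    off-diagonal : ∀ q → q < suc n → q ≢ n ∸ s → when (s ℕ.+ q ≟ n) (g q) ≈ 0#
    off-diagonal q _ q≢n∸s = when-false (s ℕ.+ q ≟ n)
      (λ s+q≡n → q≢n∸s (≡.trans (≡.sym (ℕP.m+n∸m≡n s q)) (≡.cong (_∸ s) s+q≡n)))
  ... | no s≰n = Σ-zero (suc n) (λ q _ → when-false (s ℕ.+ q ≟ n)
                   (λ s+q≡n → s≰n (≡.subst (s ≤_) s+q≡n (ℕP.m≤m+n s q))))

  Σ³-antidiagonal : ∀ n (F : ℕ → ℕ → ℕ → Carrier) →
    Σ≤ n (λ k → Σ≤ n (λ p → Σ≤ n (λ q → when (k ℕ.+ p ℕ.+ q ≟ n) (F k p q))))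
    ≈ Σ≤ n (λ k → Σ≤ (n ∸ k) (λ p → F k p (n ∸ k ∸ p)))
  Σ³-antidiagonal n F = Σ-cong (suc n) (λ k k≤n → begin
    Σ≤ n (λ p → Σ≤ n (λ q → when (k ℕ.+ p ℕ.+ q ≟ n) (F k p q)))
      ≈⟨ Σ-cong (suc n) (λ p _ → Σ-antidiagonal n (k ℕ.+ p) (F k p)) ⟩
    Σ≤ n (λ p → when (k ℕ.+ p ≤? n) (F k p (n ∸ (k ℕ.+ p))))
      ≈⟨ Σ-cong (suc n) (λ p _ → when-⇔ (k ℕ.+ p ≤? n) (p ≤? n ∸ k) m+n≤o⇒n≤o∸m
                                   (m≤o⇒n≤o∸m⇒m+n≤o (ℕP.≤-pred k≤n))) ⟩
    Σ≤ n (λ p → when (p ≤? n ∸ k) (F k p (n ∸ (k ℕ.+ p))))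
      ≈⟨ sym (Σ≤-restrict (n ∸ k) n _ (ℕP.m∸n≤m n k)) ⟩
    Σ≤ (n ∸ k) (λ p → F k p (n ∸ (k ℕ.+ p)))
      ≈⟨ Σ-cong (suc (n ∸ k)) (λ p _ →
           reflexive (≡.cong (F k p) (≡.sym (ℕP.∸-+-assoc n k p)))) ⟩
    Σ≤ (n ∸ k) (λ p → F k p (n ∸ k ∸ p)) ∎)

  -- In a J-tuple summing to N ≤ b at most one entry k is large (b < 2k); bigPart counts the
  -- tuples having one, which may sit in any of the J positions.
  bigPart : Series → ℕ → ℕ → Series
  bigPart X b J N = J · Σ≤ N (λ p → when (b <? 2 ℕ.* p) (X p * pow X (J ∸ 1) (N ∸ p)))

  Σ-small-large-swap : ∀ (X Q : Series) N b → N ≤ b →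
    Σ≤ N (λ k → when (2 ℕ.* k ≤? b)
      (X k * Σ≤ (N ∸ k) (λ p → when (b <? 2 ℕ.* p) (X p * Q (N ∸ k ∸ p)))))
    ≈ Σ≤ N (λ p → when (b <? 2 ℕ.* p) (X p * Σ≤ (N ∸ p) (λ k → X k * Q (N ∸ p ∸ k))))
  Σ-small-large-swap X Q N b N≤b = begin
    Σ≤ N (λ k → when (2 ℕ.* k ≤? b)
      (X k * Σ≤ (N ∸ k) (λ p → when (b <? 2 ℕ.* p) (X p * Q (N ∸ k ∸ p)))))
      ≈⟨ Σ-cong (suc N) (λ k _ → small-inside k) ⟩
    Σ≤ N (λ k → Σ≤ (N ∸ k) (f k))
      ≈⟨ Σ-triangle N f ⟩
    Σ≤ N (λ p → Σ≤ (N ∸ p) (λ k → f k p))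
      ≈⟨ Σ-cong (suc N) (λ p p≤N → sym (large-inside p (ℕP.≤-pred p≤N))) ⟩
    Σ≤ N (λ p → when (b <? 2 ℕ.* p) (X p * Σ≤ (N ∸ p) (λ k → X k * Q (N ∸ p ∸ k)))) ∎
    where
    f : ℕ → ℕ → Carrier
    f k p = when (2 ℕ.* k ≤? b) (when (b <? 2 ℕ.* p) (X k * (X p * Q (N ∸ k ∸ p))))

    small-inside : ∀ k → when (2 ℕ.* k ≤? b)
      (X k * Σ≤ (N ∸ k) (λ p → when (b <? 2 ℕ.* p) (X p * Q (N ∸ k ∸ p)))) ≈ Σ≤ (N ∸ k) (f k)
    small-inside k = trans (when-congʳ (2 ℕ.* k ≤? b) (trans (*-distribˡ-Σ (suc (N ∸ k)) (X k) _)
        (Σ-cong (suc (N ∸ k)) (λ p _ → *-when (b <? 2 ℕ.* p) (X k) _))))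
      (when-Σ (2 ℕ.* k ≤? b) (suc (N ∸ k)) _)

    large-inside : ∀ p → p ≤ N → when (b <? 2 ℕ.* p)
      (X p * Σ≤ (N ∸ p) (λ k → X k * Q (N ∸ p ∸ k))) ≈ Σ≤ (N ∸ p) (λ k → f k p)
    large-inside p p≤N = begin
      when large (X p * Σ≤ (N ∸ p) (λ k → X k * Q (N ∸ p ∸ k)))
        ≈⟨ when-congʳ large (*-distribˡ-Σ (suc (N ∸ p)) (X p) _) ⟩
      when large (Σ≤ (N ∸ p) (λ k → X p * (X k * Q (N ∸ p ∸ k))))
        ≈⟨ when-Σ large (suc (N ∸ p)) _ ⟩
      Σ≤ (N ∸ p) (λ k → when large (X p * (X k * Q (N ∸ p ∸ k))))
        ≈⟨ Σ-cong (suc (N ∸ p)) (λ k _ → when-congʳ large (trans (x∙yz≈y∙xz _ _ _)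
             (*-congˡ (*-congˡ (reflexive (≡.cong Q (∸-∸-comm N p k))))))) ⟩
      Σ≤ (N ∸ p) (λ k → when large (X k * (X p * Q (N ∸ k ∸ p))))
        ≈⟨ Σ-cong (suc (N ∸ p)) (λ k k≤N∸p →
             sym (when-⇒ (2 ℕ.* k ≤? b) large (small k (ℕP.≤-pred k≤N∸p)))) ⟩
      Σ≤ (N ∸ p) (λ k → f k p) ∎
      where
      large : Dec (b < 2 ℕ.* p)
      large = b <? 2 ℕ.* p

      -- k + p ≤ b < 2p forces k < p
      small : ∀ k → k ≤ N ∸ p → b < 2 ℕ.* p → 2 ℕ.* k ≤ b
      small k k≤N∸p = +≤⇒<2*⇒2*≤ {k} {p} (ℕP.≤-trans (ℕP.m≤o∸n⇒m+n≤o k p≤N k≤N∸p) N≤b)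

  Σ-small-bigPart : ∀ X J N b → N ≤ b →
    Σ≤ N (λ k → when (2 ℕ.* k ≤? b) (X k * bigPart X b J (N ∸ k)))
    ≈ J · Σ≤ N (λ p → when (b <? 2 ℕ.* p) (X p * pow X J (N ∸ p)))
  Σ-small-bigPart X zero    N b _   =
    Σ-zero (suc N) (λ k _ → when-zero (2 ℕ.* k ≤? b) (λ _ → zeroʳ (X k)))
  Σ-small-bigPart X (suc J) N b N≤b = begin
    Σ≤ N (λ k → when (2 ℕ.* k ≤? b) (X k * bigPart X b (suc J) (N ∸ k)))
      ≈⟨ Σ-cong (suc N) (λ k _ → trans (when-congʳ (2 ℕ.* k ≤? b) (·-comm-* (suc J) (X k) _))
                                       (sym (·-when (2 ℕ.* k ≤? b) (suc J) _))) ⟩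
    Σ≤ N (λ k → suc J · when (2 ℕ.* k ≤? b) (X k * S k))
      ≈⟨ sym (·-distrib-Σ (suc N) (suc J) _) ⟩
    suc J · Σ≤ N (λ k → when (2 ℕ.* k ≤? b) (X k * S k))
      ≈⟨ ·-congʳ (suc J) (Σ-small-large-swap X (pow X J) N b N≤b) ⟩
    suc J · Σ≤ N (λ p → when (b <? 2 ℕ.* p) (X p * pow X (suc J) (N ∸ p))) ∎
    where
    S : ℕ → Carrier
    S k = Σ≤ (N ∸ k) (λ p → when (b <? 2 ℕ.* p) (X p * pow X J (N ∸ k ∸ p)))

  pow-split : ∀ X J N b → N ≤ b → pow X J N ≈ rpow X b J N + bigPart X b J N
  pow-split X zero    zero    b _   = sym (+-identityʳ 1#)
  pow-split X zero    (suc N) b _   = sym (+-identityʳ 0#)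
  pow-split X (suc J) N       b N≤b = begin
    Σ≤ N (λ k → X k * pow X J (N ∸ k))
      ≈⟨ Σ-cong (suc N) (λ k _ → split k) ⟩
    Σ≤ N (λ k → small k + (smallBig k + large k))
      ≈⟨ trans (Σ-distrib-+ (suc N) _ _) (+-congˡ (Σ-distrib-+ (suc N) _ _)) ⟩
    rpow X b (suc J) N + (Σ≤ N smallBig + Σ≤ N large)
      ≈⟨ +-congˡ (trans (+-congʳ (Σ-small-bigPart X J N b N≤b)) (+-comm _ _)) ⟩
    rpow X b (suc J) N + bigPart X b (suc J) N ∎
    where
    small smallBig large : ℕ → Carrier
    small    k = when (2 ℕ.* k ≤? b) (X k * rpow X b J (N ∸ k))
    smallBig k = when (2 ℕ.* k ≤? b) (X k * bigPart X b J (N ∸ k))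
    large    k = when (b <? 2 ℕ.* k) (X k * pow X J (N ∸ k))

    split : ∀ k → X k * pow X J (N ∸ k) ≈ small k + (smallBig k + large k)
    split k = begin
      X k * pow X J (N ∸ k)
        ≈⟨ when-complement (2 ℕ.* k ≤? b) (b <? 2 ℕ.* k) ℕP.≤⇒≯ (ℕP.≤-<-connex (2 ℕ.* k) b) ⟩
      when (2 ℕ.* k ≤? b) (X k * pow X J (N ∸ k)) + large k
        ≈⟨ +-congʳ (when-congʳ (2 ℕ.* k ≤? b) (trans (*-congˡ
             (pow-split X J (N ∸ k) b (ℕP.≤-trans (ℕP.m∸n≤m N k) N≤b))) (distribˡ _ _ _))) ⟩
      when (2 ℕ.* k ≤? b) (X k * rpow X b J (N ∸ k) + X k * bigPart X b J (N ∸ k)) + large k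
        ≈⟨ +-congʳ (when-distrib-+ (2 ℕ.* k ≤? b) _ _) ⟩
      (small k + smallBig k) + large k
        ≈⟨ +-assoc _ _ _ ⟩
      small k + (smallBig k + large k) ∎

  -- The j-th summands of ε and of Σ_{2ℓ<n} (A'(X))_ℓ X_{n-ℓ} = headSum + γ.
  εSummand : Series → Series → ℕ → ℕ → Carrier
  εSummand A X j n = Σ≤ n (λ k → Σ≤ n (λ p → Σ≤ n (λ q →
    when ((k ℕ.+ p ℕ.+ q ≟ n) ×-dec ((q <? p) ×-dec (2 ℕ.* p ≤? n)))
         (j · (A k * pow X (j ∸ 1) q * X p)))))

  derivSummand : Series → Series → ℕ → ℕ → Carrier
  derivSummand A X j n =
    Σ< n (λ l → when (2 ℕ.* l <? n) (j · (A ⊛ pow X (j ∸ 1)) l * X (n ∸ l)))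

  module _ (A X : Series) (j n : ℕ) where

    private
      Q : Series
      Q = pow X (j ∸ 1)

      T : ℕ → ℕ → ℕ → Carrier
      T k p q = j · (A k * Q q * X p)

      T′ : ℕ → ℕ → Carrier
      T′ k p = T k p (n ∸ k ∸ p)

    *-bigPart : ∀ k → A k * bigPart X (n ∸ k) j (n ∸ k)
      ≈ Σ≤ (n ∸ k) (λ p → when (n ∸ k <? 2 ℕ.* p) (T′ k p))
    *-bigPart k = begin
      A k * (j · Σ≤ M (λ p → when (M <? 2 ℕ.* p) (X p * Q (M ∸ p))))
        ≈⟨ ·-comm-* j (A k) _ ⟩
      j · (A k * Σ≤ M (λ p → when (M <? 2 ℕ.* p) (X p * Q (M ∸ p))))
        ≈⟨ ·-congʳ j (*-distribˡ-Σ (suc M) (A k) _) ⟩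
      j · Σ≤ M (λ p → A k * when (M <? 2 ℕ.* p) (X p * Q (M ∸ p)))
        ≈⟨ ·-distrib-Σ (suc M) j _ ⟩
      Σ≤ M (λ p → j · (A k * when (M <? 2 ℕ.* p) (X p * Q (M ∸ p))))
        ≈⟨ Σ-cong (suc M) (λ p _ → trans (·-congʳ j (*-when (M <? 2 ℕ.* p) (A k) _))
             (trans (·-when (M <? 2 ℕ.* p) j _)
                    (when-congʳ (M <? 2 ℕ.* p) (·-congʳ j (x∙yz≈xz∙y (A k) (X p) _))))) ⟩
      Σ≤ M (λ p → when (M <? 2 ℕ.* p) (T k p (M ∸ p))) ∎
      where
      M : ℕ
      M = n ∸ k

    -- As n ∸ k = p + q with q = n ∸ k ∸ p, the guard 2p > n ∸ k says q < p.
    large-split : ∀ k p → p ≤ n ∸ k →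
      when (n ∸ k <? 2 ℕ.* p) (T′ k p)
      ≈ when (n <? 2 ℕ.* p) (T′ k p)
        + when ((n ∸ k ∸ p <? p) ×-dec (2 ℕ.* p ≤? n)) (T′ k p)
    large-split k p p≤n∸k = sym (when-partition (n <? 2 ℕ.* p) _ (n ∸ k <? 2 ℕ.* p)
      (λ n<2p q<p×2p≤n → ℕP.<⇒≱ n<2p (proj₂ q<p×2p≤n))
      (ℕP.≤-<-trans (ℕP.m∸n≤m n k))
      (λ q<p×2p≤n → ∸<⇒<2* p≤n∸k (proj₁ q<p×2p≤n))
      (λ n∸k<2p → map₂ (λ 2p≤n → <2*⇒∸< p≤n∸k n∸k<2p , 2p≤n)
                        (ℕP.<-≤-connex n (2 ℕ.* p))))

    εSummand-triangle : εSummand A X j n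
      ≈ Σ≤ n (λ k → Σ≤ (n ∸ k) (λ p →
          when ((n ∸ k ∸ p <? p) ×-dec (2 ℕ.* p ≤? n)) (T′ k p)))
    εSummand-triangle = trans
      (Σ-cong (suc n) (λ k _ → Σ-cong (suc n) (λ p _ → Σ-cong (suc n) (λ q _ →
        when-×-dec (k ℕ.+ p ℕ.+ q ≟ n) ((q <? p) ×-dec (2 ℕ.* p ≤? n))))))
      (Σ³-antidiagonal n (λ k p q → when ((q <? p) ×-dec (2 ℕ.* p ≤? n)) (T k p q)))

    derivSummand-triangle : derivSummand A X j n
      ≈ Σ≤ n (λ k → Σ≤ (n ∸ k) (λ p → when (n <? 2 ℕ.* p) (T′ k p)))
    derivSummand-triangle = begin
      Σ< n h
        ≈⟨ sym (+-identityʳ _) ⟩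
      Σ< n h + 0#
        ≈⟨ +-congˡ (sym (when-false (2 ℕ.* n <? n) (λ 2n<n → ℕP.<⇒≱ 2n<n (ℕP.m≤m+n n _)))) ⟩
      Σ≤ n h
        ≈⟨ Σ-reverse n h ⟩
      Σ≤ n (λ p → h (n ∸ p))
        ≈⟨ Σ-cong (suc n) (λ p p≤n → reindex p (ℕP.≤-pred p≤n)) ⟩
      Σ≤ n (λ p → Σ≤ (n ∸ p) (λ k → when (n <? 2 ℕ.* p) (T′ k p)))
        ≈⟨ sym (Σ-triangle n (λ k p → when (n <? 2 ℕ.* p) (T′ k p))) ⟩
      Σ≤ n (λ k → Σ≤ (n ∸ k) (λ p → when (n <? 2 ℕ.* p) (T′ k p))) ∎
      where
      h : ℕ → Carrier
      h l = when (2 ℕ.* l <? n) (j · (A ⊛ Q) l * X (n ∸ l))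

      reindex : ∀ p → p ≤ n →
        h (n ∸ p) ≈ Σ≤ (n ∸ p) (λ k → when (n <? 2 ℕ.* p) (T′ k p))
      reindex p p≤n = begin
        when (2 ℕ.* (n ∸ p) <? n) (j · (A ⊛ Q) (n ∸ p) * X (n ∸ (n ∸ p)))
          ≈⟨ when-⇔ (2 ℕ.* (n ∸ p) <? n) (n <? 2 ℕ.* p)
               (2*[m∸n]<m⇒m<2*n p≤n) (m<2*n⇒2*[m∸n]<m p≤n) ⟩
        when (n <? 2 ℕ.* p) (j · (A ⊛ Q) (n ∸ p) * X (n ∸ (n ∸ p)))
          ≈⟨ when-congʳ (n <? 2 ℕ.* p) (*-congˡ (reflexive (≡.cong X (ℕP.m∸[m∸n]≡n p≤n)))) ⟩
        when (n <? 2 ℕ.* p) ((j · Σ≤ (n ∸ p) (λ k → A k * Q (n ∸ p ∸ k))) * X p)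
          ≈⟨ when-congʳ (n <? 2 ℕ.* p) (trans (·-assoc-* j _ _) (trans
               (·-congʳ j (*-distribʳ-Σ (suc (n ∸ p)) (X p) _)) (·-distrib-Σ (suc (n ∸ p)) j _))) ⟩
        when (n <? 2 ℕ.* p) (Σ≤ (n ∸ p) (λ k → j · (A k * Q (n ∸ p ∸ k) * X p)))
          ≈⟨ when-Σ (n <? 2 ℕ.* p) (suc (n ∸ p)) _ ⟩
        Σ≤ (n ∸ p) (λ k → when (n <? 2 ℕ.* p) (j · (A k * Q (n ∸ p ∸ k) * X p)))
          ≈⟨ Σ-cong (suc (n ∸ p)) (λ k _ → reflexive
               (≡.cong (λ q → when (n <? 2 ℕ.* p) (T k p q)) (∸-∸-comm n p k))) ⟩
        Σ≤ (n ∸ p) (λ k → when (n <? 2 ℕ.* p) (T′ k p)) ∎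

    convolve-pow : (A ⊛ pow X j) n ≈ (A ⊛ brk X j) n + (derivSummand A X j n + εSummand A X j n)
    convolve-pow = begin
      Σ≤ n (λ k → A k * pow X j (n ∸ k))
        ≈⟨ Σ-cong (suc n) (λ k _ → trans
             (*-congˡ (pow-split X j (n ∸ k) (n ∸ k) ℕP.≤-refl)) (distribˡ _ _ _)) ⟩
      Σ≤ n (λ k → A k * brk X j (n ∸ k) + A k * bigPart X (n ∸ k) j (n ∸ k))
        ≈⟨ Σ-distrib-+ (suc n) _ _ ⟩
      (A ⊛ brk X j) n + Σ≤ n (λ k → A k * bigPart X (n ∸ k) j (n ∸ k))
        ≈⟨ +-congˡ (Σ-cong (suc n) (λ k _ → trans (*-bigPart k)
             (trans (Σ-cong (suc (n ∸ k)) (λ p p≤ → large-split k p (ℕP.≤-pred p≤)))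
                    (Σ-distrib-+ (suc (n ∸ k)) _ _)))) ⟩
      (A ⊛ brk X j) n + Σ≤ n (λ k → Σ≤ (n ∸ k) (λ p → when (n <? 2 ℕ.* p) (T′ k p))
        + Σ≤ (n ∸ k) (λ p → when ((n ∸ k ∸ p <? p) ×-dec (2 ℕ.* p ≤? n)) (T′ k p)))
        ≈⟨ +-congˡ (trans (Σ-distrib-+ (suc n) _ _)
             (+-cong (sym derivSummand-triangle) (sym εSummand-triangle))) ⟩
      (A ⊛ brk X j) n + (derivSummand A X j n + εSummand A X j n) ∎

  headSum+γ≈Σ-derivSummand : ∀ m (A : ℕ → Series) X n lam → 2 ℕ.* lam < n →
    headSum m A X n lam + γ m A X n lam ≈ Σ≤ m (λ j → derivSummand (A j) X j n)
  headSum+γ≈Σ-derivSummand m A X n lam 2lam<n = begin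
    Σ< lam E + γ m A X n lam
      ≈⟨ +-congʳ (Σ-restrict (_<? lam) lam n E lam≤n (λ _ l<lam → l<lam) (λ _ → ℕP.≤⇒≯)) ⟩
    Σ< n (λ l → when (l <? lam) (E l)) + γ m A X n lam
      ≈⟨ sym (Σ-distrib-+ n _ _) ⟩
    Σ< n (λ l → when (l <? lam) (E l) + when ((lam ≤? l) ×-dec (2 ℕ.* l <? n)) (E l))
      ≈⟨ Σ-cong n (λ l _ → head-or-γ l) ⟩
    Σ< n (λ l → when (2 ℕ.* l <? n) (E l))
      ≈⟨ Σ-cong n (λ l _ → trans (when-congʳ (2 ℕ.* l <? n) (*-distribʳ-Σ (suc m) _ _))
                                 (when-Σ (2 ℕ.* l <? n) (suc m) _)) ⟩
    Σ< n (λ l → Σ≤ m (λ j → when (2 ℕ.* l <? n) (j · (A j ⊛ pow X (j ∸ 1)) l * X (n ∸ l))))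
      ≈⟨ Σ-swap n (suc m) _ ⟩
    Σ≤ m (λ j → derivSummand (A j) X j n) ∎
    where
    E : ℕ → Carrier
    E l = evalD m A X l * X (n ∸ l)

    lam≤n : lam ≤ n
    lam≤n = ℕP.≤-trans (ℕP.m≤m+n lam _) (ℕP.<⇒≤ 2lam<n)

    head-or-γ : ∀ l → when (l <? lam) (E l) + when ((lam ≤? l) ×-dec (2 ℕ.* l <? n)) (E l)
                      ≈ when (2 ℕ.* l <? n) (E l)
    head-or-γ l = when-partition (l <? lam) _ (2 ℕ.* l <? n)
      (λ l<lam lam≤l×_ → ℕP.<⇒≱ l<lam (proj₁ lam≤l×_))
      (λ l<lam → ℕP.<-trans (ℕP.*-monoʳ-< 2 l<lam) 2lam<n)
      proj₂
      (λ 2l<n → map₂ (_, 2l<n) (ℕP.<-≤-connex l lam))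

mainTheorem3 : {c ℓ : Level} (K : CommutativeRing c ℓ) → IsField K →
    let open PS K in
    (m : ℕ) (A : ℕ → Series) (X : Series) (n lam : ℕ) → 2 ℕ.* lam ℕ.< n →
      evalP m A X n ≈ headSum m A X n lam + γ m A X n lam + δ m A X n + ε m A X n
mainTheorem3 K _ m A X n lam 2lam<n = begin
  evalP m A X n
    ≈⟨ Σ-cong (suc m) (λ j _ → convolve-pow (A j) X j n) ⟩
  Σ≤ m (λ j → (A j ⊛ brk X j) n + (derivSummand (A j) X j n + εSummand (A j) X j n))
    ≈⟨ trans (Σ-distrib-+ (suc m) _ _) (+-congˡ (Σ-distrib-+ (suc m) _ _)) ⟩
  δ m A X n + (Σ≤ m (λ j → derivSummand (A j) X j n) + ε m A X n)
    ≈⟨ +-congˡ (+-congʳ (sym (headSum+γ≈Σ-derivSummand m A X n lam 2lam<n))) ⟩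
  δ m A X n + (headSum m A X n lam + γ m A X n lam + ε m A X n)
    ≈⟨ trans (sym (+-assoc _ _ _)) (+-congʳ (+-comm _ _)) ⟩
  headSum m A X n lam + γ m A X n lam + δ m A X n + ε m A X n ∎
  where
  open PS K
  open Expansion K
  open import Relation.Binary.Reasoning.Setoid setoid
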